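{- Let $S$ be an $E$-unitary inverse semigroup such that, for every $t\in S$, the set $t^{\uparrow}=\{u\in S: t\le u\}$ has a unique maximal element $t^{\mathfrak m}$. Then for all $t,u\in S$, $t\,\sigma_S\,u$ if and only if $t^{\mathfrak m}=u^{\mathfrak m}$.
   Context: An inverse semigroup is a semigroup with a unary operation $^*$ satisfying $(u^*)^*=u$, $(uv)^*=v^*u^*$, $uu^*u=u$, $uu^*vv^*=vv^*uu^*$. Its natural order is $u\le v$ iff $uu^*v=u$. $E(S)$ is the set of idempotents. $S$ is $E$-unitary if $e\in E(S)$ and $e\le v$ imply $v\in E(S)$. $\sigma_S$ is the relation $t\,\sigma_S\,u$ iff there is $w\in S$ with $w\le t$ and $w\le u$. -}

module Defs where

open import Level using (Level; suc; _⊔_)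
open import Relation.Binary.PropositionalEquality using (_≡_)
open import Data.Product using (Σ; ∃; _×_; _,_)

record InverseSemigroup (c : Level) : Set (suc c) where
  infixl 7 _∙_
  infix 8 _*
  field
    Carrier : Set c
    _∙_     : Carrier → Carrier → Carrier
    _*      : Carrier → Carrier
    assoc   : ∀ x y z → (x ∙ y) ∙ z ≡ x ∙ (y ∙ z)
    inv-inv : ∀ u → (u *) * ≡ u
    inv-anti : ∀ u v → (u ∙ v) * ≡ (v *) ∙ (u *)
    regular : ∀ u → u ∙ (u *) ∙ u ≡ u
    idem-comm : ∀ u v → u ∙ (u *) ∙ (v ∙ (v *)) ≡ v ∙ (v *) ∙ (u ∙ (u *))

  _≤_ : Carrier → Carrier → Set c
  u ≤ v = u ∙ (u *) ∙ v ≡ u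

  IsIdempotent : Carrier → Set c
  IsIdempotent e = e ∙ e ≡ e

  EUnitary : Set c
  EUnitary = ∀ e v → IsIdempotent e → e ≤ v → IsIdempotent v

  σ : Carrier → Carrier → Set c
  σ t u = ∃ λ w → w ≤ t × w ≤ u

  IsMaximalAbove : Carrier → Carrier → Set c
  IsMaximalAbove t m = t ≤ m × (∀ u → t ≤ u → m ≤ u → u ≡ m)

  IsUniqueMaximalAbove : Carrier → Carrier → Set c
  IsUniqueMaximalAbove t m =
    IsMaximalAbove t m × (∀ m′ → IsMaximalAbove t m′ → m′ ≡ m)

-- If w ≤ t then m t is still maximal above w, so by uniqueness m t = m w; a
-- common lower bound of t and u therefore gives m t = m u.  Conversely, if
-- t, u ≤ M then (u u*) t = (t t*) u is a common lower bound.
module Submission where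

open import Defs
open import Level using (Level)
open import Relation.Binary.PropositionalEquality
  using (_≡_; sym; trans; cong; cong₂; subst; module ≡-Reasoning)
open import Data.Product using (_,_; proj₁)
open import Function.Bundles using (_⇔_; mk⇔)

module InverseSemigroupProperties {c : Level} (S : InverseSemigroup c) where
  open InverseSemigroup S
  open ≡-Reasoning

  ∙*-idem : ∀ x → (x ∙ x *) ∙ (x ∙ x *) ≡ x ∙ x *
  ∙*-idem x = begin
    (x ∙ x *) ∙ (x ∙ x *) ≡⟨ sym (assoc (x ∙ x *) x (x *)) ⟩
    (x ∙ x * ∙ x) ∙ x *   ≡⟨ cong (_∙ x *) (regular x) ⟩
    x ∙ x *               ∎

  ∙*-selfInverse : ∀ x → (x ∙ x *) * ≡ x ∙ x *
  ∙*-selfInverse x = trans (inv-anti x (x *)) (cong (_∙ x *) (inv-inv x))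

  *-restrictˡ : ∀ x t → ((x ∙ x *) ∙ t) * ≡ t * ∙ (x ∙ x *)
  *-restrictˡ x t = trans (inv-anti (x ∙ x *) t) (cong (t * ∙_) (∙*-selfInverse x))

  ≤⇒∙*-absorbˡ : ∀ {a b} → a ≤ b → a ∙ a * ≡ (a ∙ a *) ∙ (b ∙ b *)
  ≤⇒∙*-absorbˡ {a} {b} a≤b = begin
    a ∙ a *             ≡⟨ cong₂ _∙_ (sym a≤b) a*≡b*e ⟩
    (e ∙ b) ∙ (b * ∙ e) ≡⟨ assoc e b (b * ∙ e) ⟩
    e ∙ (b ∙ (b * ∙ e)) ≡⟨ cong (e ∙_) (sym (assoc b (b *) e)) ⟩
    e ∙ (g ∙ e)         ≡⟨ cong (e ∙_) (idem-comm b a) ⟩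
    e ∙ (e ∙ g)         ≡⟨ sym (assoc e e g) ⟩
    (e ∙ e) ∙ g         ≡⟨ cong (_∙ g) (∙*-idem a) ⟩
    e ∙ g               ∎
    where
    e = a ∙ a *
    g = b ∙ b *
    a*≡b*e : a * ≡ b * ∙ e
    a*≡b*e = trans (cong _* (sym a≤b)) (*-restrictˡ a b)

  ≤-trans : ∀ {a b d} → a ≤ b → b ≤ d → a ≤ d
  ≤-trans {a} {b} {d} a≤b b≤d = begin
    (a ∙ a *) ∙ d             ≡⟨ cong (_∙ d) (≤⇒∙*-absorbˡ a≤b) ⟩
    (a ∙ a *) ∙ (b ∙ b *) ∙ d ≡⟨ assoc (a ∙ a *) (b ∙ b *) d ⟩
    (a ∙ a *) ∙ (b ∙ b * ∙ d) ≡⟨ cong ((a ∙ a *) ∙_) b≤d ⟩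
    (a ∙ a *) ∙ b             ≡⟨ a≤b ⟩
    a                         ∎

  restrictˡ-≤ : ∀ x t → ((x ∙ x *) ∙ t) ≤ t
  restrictˡ-≤ x t = begin
    (f ∙ t) ∙ (f ∙ t) * ∙ t ≡⟨ cong (λ z → (f ∙ t) ∙ z ∙ t) (*-restrictˡ x t) ⟩
    (f ∙ t) ∙ (t * ∙ f) ∙ t ≡⟨ cong (_∙ t) (assoc f t (t * ∙ f)) ⟩
    f ∙ (t ∙ (t * ∙ f)) ∙ t ≡⟨ cong (λ z → f ∙ z ∙ t) (sym (assoc t (t *) f)) ⟩
    f ∙ (e ∙ f) ∙ t         ≡⟨ cong (λ z → f ∙ z ∙ t) (idem-comm t x) ⟩
    f ∙ (f ∙ e) ∙ t         ≡⟨ cong (_∙ t) (sym (assoc f f e)) ⟩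
    (f ∙ f) ∙ e ∙ t         ≡⟨ cong (λ z → z ∙ e ∙ t) (∙*-idem x) ⟩
    f ∙ e ∙ t               ≡⟨ assoc f e t ⟩
    f ∙ (e ∙ t)             ≡⟨ cong (f ∙_) (regular t) ⟩
    f ∙ t                   ∎
    where
    f = x ∙ x *
    e = t ∙ t *

  upperBound⇒σ : ∀ {t u M} → t ≤ M → u ≤ M → σ t u
  upperBound⇒σ {t} {u} {M} t≤M u≤M =
    f ∙ t , restrictˡ-≤ u t , subst (_≤ u) (sym ft≡eu) (restrictˡ-≤ t u)
    where
    e = t ∙ t *
    f = u ∙ u *
    ft≡eu : f ∙ t ≡ e ∙ u
    ft≡eu = begin
      f ∙ t       ≡⟨ cong (f ∙_) (sym t≤M) ⟩
      f ∙ (e ∙ M) ≡⟨ sym (assoc f e M) ⟩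
      (f ∙ e) ∙ M ≡⟨ cong (_∙ M) (idem-comm u t) ⟩
      (e ∙ f) ∙ M ≡⟨ assoc e f M ⟩
      e ∙ (f ∙ M) ≡⟨ cong (e ∙_) u≤M ⟩
      e ∙ u       ∎

  maximalAbove-antitone : ∀ {w t M} → w ≤ t → IsMaximalAbove t M → IsMaximalAbove w M
  maximalAbove-antitone w≤t (t≤M , M-max) =
    ≤-trans w≤t t≤M , λ v _ M≤v → M-max v (≤-trans t≤M M≤v) M≤v

  ≤⇒uniqueMaximal-≡ : ∀ {w t Mw Mt} → w ≤ t →
    IsUniqueMaximalAbove w Mw → IsMaximalAbove t Mt → Mt ≡ Mw
  ≤⇒uniqueMaximal-≡ w≤t (_ , Mw-unique) Mt-max =
    Mw-unique _ (maximalAbove-antitone w≤t Mt-max)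

lemma3p10 : ∀ {c : Level} (S : InverseSemigroup c) →
    let open InverseSemigroup S in
    EUnitary →
    (m : Carrier → Carrier) →
    (∀ t → IsUniqueMaximalAbove t (m t)) →
    ∀ t u → σ t u ⇔ (m t ≡ m u)
lemma3p10 S _ m m-unique t u = mk⇔ σ⇒≡ ≡⇒σ
  where
  open InverseSemigroup S
  open InverseSemigroupProperties S

  m-≤ : ∀ {w t} → w ≤ t → m t ≡ m w
  m-≤ {w} {t} w≤t = ≤⇒uniqueMaximal-≡ w≤t (m-unique w) (proj₁ (m-unique t))

  σ⇒≡ : σ t u → m t ≡ m u
  σ⇒≡ (w , w≤t , w≤u) = trans (m-≤ w≤t) (sym (m-≤ w≤u))

  ≡⇒σ : m t ≡ m u → σ t u
  ≡⇒σ mt≡mu = upperBound⇒σ (proj₁ (proj₁ (m-unique t)))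
                (subst (u ≤_) (sym mt≡mu) (proj₁ (proj₁ (m-unique u))))
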